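{- Let $k$ be a positive integer, let $G$ be a $k$-degenerate graph on $n$ vertices, and let $v_1,v_2,\dots,v_n$ be a $k$-degenerate ordering of $G$. Let $r=\lceil \ln n\rceil$. Then there is a collection $\{f_1,\dots,f_r\}$, where each $f_i\colon V(G)\to[10k]$ is a proper coloring of the vertices of $G$, such that for every non-adjacent pair $(v_i,v_j)$ with $i<j$ there exists $\ell\in[r]$ such that $f_\ell$ is a desirable coloring for the pair $(v_i,v_j)$.
   Context: A $k$-degenerate ordering of $G$ is an ordering $v_1,\dots,v_n$ of $V(G)$ such that for each $i$, $|N_G(v_i)\cap\{v_{i+1},\dots,v_n\}|\le k$; $G$ is $k$-degenerate if it has such an ordering. For $i<j$ with $v_iv_j\notin E(G)$, a coloring $f$ of $V(G)$ is desirable for the non-adjacent pair $(v_i,v_j)$ if (i) $f$ is a proper coloring, and (ii) $f(v_j)\ne f(v_t)$ for every neighbor $v_t$ of $v_i$ with $t>j$. $[m]=\{1,\dots,m\}$. -}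

module Defs where

open import Data.Nat using (ℕ; zero; suc; _+_; _*_; _^_; _≤_; _<_)
open import Data.Fin using (Fin; _<?_) renaming (_<_ to _<ᶠ_)
open import Data.List using (length; filter; allFin)
open import Data.Product using (∃; _×_)
open import Relation.Nullary using (¬_)
open import Relation.Nullary.Decidable using (_×-dec_)
open import Relation.Binary using (Decidable)
open import Relation.Binary.PropositionalEquality using (_≡_; _≢_)
open import Function.Bundles using (_⤖_; Bijection)

record Graph (n : ℕ) : Set₁ where
  field
    Adj    : Fin n → Fin n → Set
    sym    : ∀ {u w} → Adj u w → Adj w u
    irrefl : ∀ {u} → ¬ Adj u u
    adj?   : Decidable Adj
open Graph public

-- An ordering v₁,…,vₙ of V(G): a bijection from positions to vertices.
Ordering : ℕ → Set
Ordering n = Fin n ⤖ Fin n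

vtx : ∀ {n} → Ordering n → Fin n → Fin n
vtx σ i = Bijection.to σ i

laterDeg : ∀ {n} (G : Graph n) (σ : Ordering n) → Fin n → ℕ
laterDeg G σ i =
  length (filter (λ t → (i <? t) ×-dec adj? G (vtx σ i) (vtx σ t)) (allFin _))

IsDegenerateOrdering : ∀ {n} → ℕ → Graph n → Ordering n → Set
IsDegenerateOrdering k G σ = ∀ i → laterDeg G σ i ≤ k

Proper : ∀ {n c} → Graph n → (Fin n → Fin c) → Set
Proper G f = ∀ u w → Adj G u w → f u ≢ f w

Desirable : ∀ {n c} → Graph n → Ordering n → (Fin n → Fin c) → Fin n → Fin n → Set
Desirable G σ f i j =
  Proper G f ×
  (∀ t → j <ᶠ t → Adj G (vtx σ i) (vtx σ t) → f (vtx σ j) ≢ f (vtx σ t))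

-- expS r m = m! * Σ_{j=0}^{m} r^j / j!   (a natural number)
expS : ℕ → ℕ → ℕ
expS r zero    = 1
expS r (suc m) = suc m * expS r m + r ^ suc m

_! : ℕ → ℕ
zero ! = 1
suc m ! = suc m * (m !)

-- n ≤ e^r  (since e^r = sup_m Σ_{j≤m} r^j/j!, and e^r is irrational for r ≥ 1,
-- n ≤ e^r iff some partial sum is ≥ n)
LeExp : ℕ → ℕ → Set
LeExp n r = ∃ λ m → n * (m !) ≤ expS r m

IsCeilLn : ℕ → ℕ → Set
IsCeilLn n r = LeExp n r × (∀ r' → r' < r → ¬ LeExp n r')

-- Colour the positions from last to first, choosing at position P a whole vector of r colours,
-- one per colouring. Coordinate ℓ must avoid the ≤ k colours that the later neighbours of P have
-- in colouring ℓ (properness), and for every i < P some coordinate ℓ must avoid the ≤ k colours of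
-- the neighbours of v_i after P (then f_ℓ is desirable for (v_i, v_P)). Such a vector exists as
-- long as fewer than 9^r pairs are pending, by a derandomised union bound: fix the coordinates one
-- at a time, taking among the ≥ 9k colours outside the forbidden set one that lies in the sets of
-- fewer than a ninth of the pending pairs; averaging provides it. Finally n ≤ e^r ≤ 9^r, where
-- e^r ≤ 2·4^r for r ≥ 1 follows by comparison with a negative binomial series.
module Submission where

open import Defs using (Graph; Adj; adj?; Ordering; vtx; IsDegenerateOrdering; Proper; Desirable;
                        expS; _!; LeExp; IsCeilLn)
open import Data.Bool.Base using (true; false; if_then_else_)
open import Data.Fin.Base using (Fin; zero; suc; toℕ; fromℕ<; punchIn) renaming (_<_ to _<ᶠ_; _≤_ to _≤ᶠ_)
import Data.Fin.Properties as Fin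
open import Data.Fin.Induction using (>-weakInduction)
open import Data.List.Base using (List; []; _∷_; length; map; filter; allFin)
open import Data.List.Properties using (length-map; length-tabulate; filter-notAll)
open import Data.List.Membership.Propositional using (_∈_; _∉_)
import Data.List.Membership.DecPropositional as DecMembership
open import Data.List.Membership.Propositional.Properties using (∈-filter⁺; ∈-map⁺; ∈-allFin)
open import Data.List.Relation.Binary.Sublist.Propositional using (⊆-refl)
open import Data.List.Relation.Binary.Sublist.Propositional.Properties
  using (length-mono-≤) renaming (filter⁺ to ⊆-filter⁺)
open import Data.List.Relation.Unary.All as All using (All; []; _∷_)
open import Data.List.Relation.Unary.All.Properties using (map⁺; map⁻; filter⁺; all-filter)
open import Data.List.Relation.Unary.Any as Any using (here)
open import Data.Nat.Base using (ℕ; zero; suc; _+_; _*_; _^_; _≤_; _<_; z≤n; s≤s; NonZero; >-nonZero; >-nonZero⁻¹)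
open import Data.Nat.Properties
open import Algebra.Properties.Semiring.Sum +-*-semiring
  using (sum; sum-syntax; ∑-distrib-+; *-distribˡ-sum; sum-remove; sum-cong-≗; sum-replicate-zero)
open import Data.Nat.Tactic.RingSolver using (solve-∀)
open import Data.Product using (∃; Σ; _×_; _,_; proj₁; proj₂)
open import Data.Vec.Functional using (head; tail; updateAt) renaming (_∷_ to _∷ᵛ_)
open import Data.Vec.Functional.Properties using (updateAt-updates; updateAt-minimal)
open import Function.Base using (_∘_; const)
open import Function.Bundles using (Inverse)
open import Function.Properties.Bijection using (⤖⇒↔)
open import Relation.Nullary using (¬_; yes; no; does; contradiction)
open import Relation.Nullary.Decidable using (_×-dec_)
open import Relation.Binary.PropositionalEquality

private variable
  n r C : ℕ

open module FinMembership {n} = DecMembership (Fin._≟_ {n}) using (_∈?_)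

-- rising x j = (x + 1)(x + 2) ⋯ (x + j) = j! · C(x + j, j)
rising : ℕ → ℕ → ℕ
rising x zero    = 1
rising x (suc j) = (x + suc j) * rising x j

-- negBinomialSum x m = 2^m · m! · Σ_{j ≤ m} C(x + j, j) / 2^j, scaling a partial sum of
-- the series (1 − 1/2)^−(x+1) = 2^(x+1)
negBinomialSum : ℕ → ℕ → ℕ
negBinomialSum x zero    = 1
negBinomialSum x (suc m) = 2 * suc m * negBinomialSum x m + rising x (suc m)

rising-zero : ∀ j → rising 0 j ≡ j !
rising-zero zero    = refl
rising-zero (suc j) = cong (suc j *_) (rising-zero j)

^*2^≤rising : ∀ r j → r ^ j * 2 ^ j ≤ rising (2 * r) j
^*2^≤rising r zero    = ≤-refl
^*2^≤rising r (suc j) = begin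
  r * r ^ j * (2 * 2 ^ j)          ≡⟨ lemma r (r ^ j) (2 ^ j) ⟩
  2 * r * (r ^ j * 2 ^ j)          ≤⟨ *-mono-≤ (m≤m+n (2 * r) (suc j)) (^*2^≤rising r j) ⟩
  (2 * r + suc j) * rising (2 * r) j ∎
  where
  open ≤-Reasoning
  lemma : ∀ r p q → r * p * (2 * q) ≡ 2 * r * (p * q)
  lemma = solve-∀

rising-suc : ∀ x j → rising x (suc j) ≡ suc x * rising (suc x) j
rising-suc x zero    = cong (_* 1) (+-comm x 1)
rising-suc x (suc j) = begin
  (x + suc (suc j)) * rising x (suc j)        ≡⟨ cong ((x + suc (suc j)) *_) (rising-suc x j) ⟩
  (x + suc (suc j)) * (suc x * rising (suc x) j) ≡⟨ lemma x j (rising (suc x) j) ⟩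
  suc x * ((suc x + suc j) * rising (suc x) j) ∎
  where
  open ≡-Reasoning
  lemma : ∀ x j q → (x + suc (suc j)) * (suc x * q) ≡ suc x * ((suc x + suc j) * q)
  lemma = solve-∀

rising-pascal : ∀ x j → rising (suc x) (suc j) ≡ rising x (suc j) + suc j * rising (suc x) j
rising-pascal x j rewrite rising-suc x j = lemma x j (rising (suc x) j)
  where
  lemma : ∀ x j q → (suc x + suc j) * q ≡ suc x * q + suc j * q
  lemma = solve-∀

negBinomialSum-pascal : ∀ x m → negBinomialSum (suc x) m + rising (suc x) m ≡ 2 * negBinomialSum x m
negBinomialSum-pascal x zero    = refl
negBinomialSum-pascal x (suc m) = begin
  2 * suc m * S₁ + R₁ (suc m) + R₁ (suc m)
    ≡⟨ cong (λ z → 2 * suc m * S₁ + z + z) (rising-pascal x m) ⟩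
  2 * suc m * S₁ + (R₀ + suc m * R₁ m) + (R₀ + suc m * R₁ m)
    ≡⟨ lemma m S₁ R₀ (R₁ m) ⟩
  2 * suc m * (S₁ + R₁ m) + 2 * R₀
    ≡⟨ cong (λ z → 2 * suc m * z + 2 * R₀) (negBinomialSum-pascal x m) ⟩
  2 * suc m * (2 * negBinomialSum x m) + 2 * R₀
    ≡⟨ lemma′ m (negBinomialSum x m) R₀ ⟩
  2 * (2 * suc m * negBinomialSum x m + R₀)
    ∎
  where
  open ≡-Reasoning
  S₁ = negBinomialSum (suc x) m
  R₁ = rising (suc x)
  R₀ = rising x (suc m)
  lemma : ∀ m v a b → 2 * suc m * v + (a + suc m * b) + (a + suc m * b) ≡ 2 * suc m * (v + b) + 2 * a
  lemma = solve-∀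
  lemma′ : ∀ m v a → 2 * suc m * (2 * v) + 2 * a ≡ 2 * (2 * suc m * v + a)
  lemma′ = solve-∀

negBinomialSum≤2^* : ∀ x m → negBinomialSum x m ≤ 2 ^ x * negBinomialSum 0 m
negBinomialSum≤2^* zero    m = ≤-reflexive (sym (+-identityʳ _))
negBinomialSum≤2^* (suc x) m = begin
  negBinomialSum (suc x) m                          ≤⟨ m≤m+n _ (rising (suc x) m) ⟩
  negBinomialSum (suc x) m + rising (suc x) m       ≡⟨ negBinomialSum-pascal x m ⟩
  2 * negBinomialSum x m                            ≤⟨ *-monoʳ-≤ 2 (negBinomialSum≤2^* x m) ⟩
  2 * (2 ^ x * negBinomialSum 0 m)                  ≡⟨ *-assoc 2 (2 ^ x) _ ⟨
  2 ^ suc x * negBinomialSum 0 m                    ∎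
  where open ≤-Reasoning

negBinomialSum-0+m!≤ : ∀ m → negBinomialSum 0 m + m ! ≤ m ! * 2 ^ suc m
negBinomialSum-0+m!≤ zero    = s≤s (s≤s z≤n)
negBinomialSum-0+m!≤ (suc m) = begin
  2 * suc m * negBinomialSum 0 m + rising 0 (suc m) + suc m * m !
    ≡⟨ cong (λ z → 2 * suc m * negBinomialSum 0 m + z + suc m * m !) (rising-zero (suc m)) ⟩
  2 * suc m * negBinomialSum 0 m + suc m * m ! + suc m * m !
    ≡⟨ lemma m (negBinomialSum 0 m) (m !) ⟩
  2 * suc m * (negBinomialSum 0 m + m !)
    ≤⟨ *-monoʳ-≤ (2 * suc m) (negBinomialSum-0+m!≤ m) ⟩
  2 * suc m * (m ! * 2 ^ suc m)
    ≡⟨ lemma′ m (m !) (2 ^ suc m) ⟩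
  suc m * m ! * (2 * 2 ^ suc m)
    ∎
  where
  open ≤-Reasoning
  lemma : ∀ m v f → 2 * suc m * v + suc m * f + suc m * f ≡ 2 * suc m * (v + f)
  lemma = solve-∀
  lemma′ : ∀ m f p → 2 * suc m * (f * p) ≡ suc m * f * (2 * p)
  lemma′ = solve-∀

expS*2^≤negBinomialSum : ∀ r m → expS r m * 2 ^ m ≤ negBinomialSum (2 * r) m
expS*2^≤negBinomialSum r zero    = ≤-refl
expS*2^≤negBinomialSum r (suc m) = begin
  (suc m * expS r m + r ^ suc m) * (2 * 2 ^ m)
    ≡⟨ lemma m (expS r m) (r ^ suc m) (2 ^ m) ⟩
  2 * suc m * (expS r m * 2 ^ m) + r ^ suc m * 2 ^ suc m
    ≤⟨ +-mono-≤ (*-monoʳ-≤ (2 * suc m) (expS*2^≤negBinomialSum r m)) (^*2^≤rising r (suc m)) ⟩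
  2 * suc m * negBinomialSum (2 * r) m + rising (2 * r) (suc m)
    ∎
  where
  open ≤-Reasoning
  lemma : ∀ m e p q → (suc m * e + p) * (2 * q) ≡ 2 * suc m * (e * q) + p * (2 * q)
  lemma = solve-∀

expS-zero : ∀ m → expS 0 m ≡ m !
expS-zero zero    = refl
expS-zero (suc m) = trans (+-identityʳ _) (cong (suc m *_) (expS-zero m))

expS≤2*4^r*m! : ∀ r m → expS r m ≤ 2 * 4 ^ r * m !
expS≤2*4^r*m! r m = *-cancelʳ-≤ _ _ (2 ^ m) {{m^n≢0 2 m}} (begin
  expS r m * 2 ^ m                   ≤⟨ expS*2^≤negBinomialSum r m ⟩
  negBinomialSum (2 * r) m           ≤⟨ negBinomialSum≤2^* (2 * r) m ⟩
  2 ^ (2 * r) * negBinomialSum 0 m   ≤⟨ *-monoʳ-≤ (2 ^ (2 * r)) (≤-trans (m≤m+n _ (m !)) (negBinomialSum-0+m!≤ m)) ⟩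
  2 ^ (2 * r) * (m ! * 2 ^ suc m)    ≡⟨ cong (_* (m ! * 2 ^ suc m)) (^-*-assoc 2 2 r) ⟨
  4 ^ r * (m ! * (2 * 2 ^ m))        ≡⟨ lemma (4 ^ r) (m !) (2 ^ m) ⟩
  2 * 4 ^ r * m ! * 2 ^ m            ∎)
  where
  open ≤-Reasoning
  lemma : ∀ a f p → a * (f * (2 * p)) ≡ 2 * a * f * p
  lemma = solve-∀

1≤m! : ∀ m → 1 ≤ m !
1≤m! zero    = ≤-refl
1≤m! (suc m) = ≤-trans (1≤m! m) (m≤m+n (m !) (m * m !))

2*4^[1+r]≤9^[1+r] : ∀ r → 2 * 4 ^ suc r ≤ 9 ^ suc r
2*4^[1+r]≤9^[1+r] r = begin
  2 * (4 * 4 ^ r)    ≡⟨ *-assoc 2 4 (4 ^ r) ⟨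
  8 * 4 ^ r          ≤⟨ *-mono-≤ (n≤1+n 8) (^-monoˡ-≤ r (m≤m+n 4 5)) ⟩
  9 * 9 ^ r          ∎
  where open ≤-Reasoning

expS≤9^r*m! : ∀ r m → expS r m ≤ 9 ^ r * m !
expS≤9^r*m! zero    m = ≤-reflexive (trans (expS-zero m) (sym (+-identityʳ (m !))))
expS≤9^r*m! (suc r) m = ≤-trans (expS≤2*4^r*m! (suc r) m) (*-monoˡ-≤ (m !) (2*4^[1+r]≤9^[1+r] r))

LeExp⇒≤9^ : ∀ {n r} → LeExp n r → n ≤ 9 ^ r
LeExp⇒≤9^ {n} {r} (m , n*m!≤) =
  *-cancelʳ-≤ n (9 ^ r) (m !) {{>-nonZero (1≤m! m)}} (≤-trans n*m!≤ (expS≤9^r*m! r m))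

sum<⇒∃< : ∀ {n} t (w : Fin n → ℕ) → sum w < n * t → ∃ λ x → w x < t
sum<⇒∃< {zero}  t w ()
sum<⇒∃< {suc n} t w ∑w< with w zero <? t
... | yes w₀<t = zero , w₀<t
... | no  w₀≮t with sum<⇒∃< t (tail w) (+-cancelˡ-< t _ _ (≤-<-trans (+-monoˡ-≤ _ (≮⇒≥ w₀≮t)) ∑w<))
...   | x , wx<t = suc x , wx<t

𝟙[_∈_] : Fin C → List (Fin C) → ℕ
𝟙[ x ∈ L ] = if does (x ∈? L) then 1 else 0

𝟙[∈∷]≡𝟙[∈] : ∀ {x y : Fin C} L → x ≢ y → 𝟙[ x ∈ y ∷ L ] ≡ 𝟙[ x ∈ L ]
𝟙[∈∷]≡𝟙[∈] {x = x} {y} L x≢y with x Fin.≟ y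
... | yes x≡y = contradiction x≡y x≢y
... | no  _   = refl

∈⇒𝟙≡1 : ∀ {x : Fin C} {L} → x ∈ L → 𝟙[ x ∈ L ] ≡ 1
∈⇒𝟙≡1 {x = x} {L} x∈L with x ∈? L
... | yes _   = refl
... | no  x∉L = contradiction x∈L x∉L

∑𝟙∈≤length : ∀ (L : List (Fin C)) → ∑[ x < C ] 𝟙[ x ∈ L ] ≤ length L
∑𝟙∈≤length {zero}  L       = z≤n
∑𝟙∈≤length {suc C} []      = ≤-reflexive (sum-replicate-zero (suc C))
∑𝟙∈≤length {suc C} (y ∷ L) = begin
  ∑[ x < suc C ] 𝟙[ x ∈ y ∷ L ]                       ≡⟨ sum-remove {i = y} (λ x → 𝟙[ x ∈ y ∷ L ]) ⟩
  𝟙[ y ∈ y ∷ L ] + ∑[ j < C ] 𝟙[ punchIn y j ∈ y ∷ L ] ≡⟨ cong₂ _+_ (∈⇒𝟙≡1 {x = y} {y ∷ L} (here refl))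
                                                                    (sum-cong-≗ (λ j → 𝟙[∈∷]≡𝟙[∈] L (Fin.punchInᵢ≢i y j))) ⟩
  1 + ∑[ j < C ] 𝟙[ punchIn y j ∈ L ]                  ≤⟨ s≤s (m≤n+m _ 𝟙[ y ∈ L ]) ⟩
  1 + (𝟙[ y ∈ L ] + ∑[ j < C ] 𝟙[ punchIn y j ∈ L ])   ≡⟨ cong suc (sum-remove {i = y} (λ x → 𝟙[ x ∈ L ])) ⟨
  1 + ∑[ x < suc C ] 𝟙[ x ∈ L ]                        ≤⟨ s≤s (∑𝟙∈≤length L) ⟩
  1 + length L                                         ∎
  where open ≤-Reasoning

ColourSets : ℕ → ℕ → Set
ColourSets r C = Fin r → List (Fin C)

Escapes : (Fin r → Fin C) → ColourSets r C → Set
Escapes c B = ∃ λ ℓ → c ℓ ∉ B ℓ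

Avoids : (Fin r → Fin C) → ColourSets r C → Set
Avoids c F = ∀ ℓ → c ℓ ∉ F ℓ

BoundedBy : ℕ → ColourSets r C → Set
BoundedBy K B = ∀ ℓ → length (B ℓ) ≤ K

-- The families in bs whose first set contains x, with that set dropped: once the first colour
-- is x, these must still be escaped through the remaining coordinates.
hitBy : Fin C → List (ColourSets (suc r) C) → List (ColourSets r C)
hitBy x = map tail ∘ filter (λ B → x ∈? head B)

length-hitBy-∷ : ∀ (x : Fin C) (B : ColourSets (suc r) C) bs →
                 length (hitBy x (B ∷ bs)) ≡ 𝟙[ x ∈ head B ] + length (hitBy x bs)
length-hitBy-∷ x B bs with does (x ∈? head B)
... | true  = refl
... | false = refl

∑-length-hitBy≤ : ∀ {K} (bs : List (ColourSets (suc r) C)) → All (BoundedBy K) bs →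
                  ∑[ x < C ] length (hitBy x bs) ≤ K * length bs
∑-length-hitBy≤ {C = C} {K = K} [] [] = ≤-reflexive (trans (sum-replicate-zero C) (sym (*-zeroʳ K)))
∑-length-hitBy≤ {K = K} (B ∷ bs) (B≤K ∷ bs≤K) = begin
  ∑[ x < _ ] length (hitBy x (B ∷ bs))
    ≡⟨ sum-cong-≗ (λ x → length-hitBy-∷ x B bs) ⟩
  ∑[ x < _ ] (𝟙[ x ∈ head B ] + length (hitBy x bs))
    ≡⟨ ∑-distrib-+ (λ x → 𝟙[ x ∈ head B ]) (λ x → length (hitBy x bs)) ⟩
  ∑[ x < _ ] 𝟙[ x ∈ head B ] + ∑[ x < _ ] length (hitBy x bs)
    ≤⟨ +-mono-≤ (≤-trans (∑𝟙∈≤length (head B)) (B≤K zero)) (∑-length-hitBy≤ bs bs≤K) ⟩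
  K + K * length bs
    ≡⟨ *-suc K _ ⟨
  K * suc (length bs)
    ∎
  where open ≤-Reasoning

hitBy-bounded : ∀ {K} (x : Fin C) (bs : List (ColourSets (suc r) C)) →
                All (BoundedBy K) bs → All (BoundedBy K) (hitBy x bs)
hitBy-bounded x bs bs≤K = map⁺ (filter⁺ (λ B → x ∈? head B) (All.map (_∘ suc) bs≤K))

avoids-∷ : ∀ {x} {c : Fin r → Fin C} {F} → x ∉ head F → Avoids c (tail F) → Avoids (x ∷ᵛ c) F
avoids-∷ x∉F₀ avoids zero    = x∉F₀
avoids-∷ x∉F₀ avoids (suc ℓ) = avoids ℓ

escapes-hitBy : ∀ (x : Fin C) (c : Fin r → Fin C) bs →
                All (Escapes c) (hitBy x bs) → All (Escapes (x ∷ᵛ c)) bs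
escapes-hitBy x c []       _   = []
escapes-hitBy x c (B ∷ bs) esc with x ∈? head B | esc
... | yes _    | (ℓ , cℓ∉Bℓ) ∷ escs = (suc ℓ , cℓ∉Bℓ) ∷ escapes-hitBy x c bs escs
... | no  x∉B₀ | escs               = (zero , x∉B₀) ∷ escapes-hitBy x c bs escs

module Choice {C} (b K : ℕ) .{{_ : NonZero K}} (K+bK≤C : K + b * K ≤ C) where

  -- Colours in F₀ get weight t, so a colour of weight < t, which exists by averaging,
  -- lies outside F₀ and in the first set of fewer than t of the families.
  firstColour : ∀ {r} (F₀ : List (Fin C)) (bs : List (ColourSets (suc r) C)) →
                length F₀ ≤ K → All (BoundedBy K) bs → length bs < b ^ suc r →
                ∃ λ x → x ∉ F₀ × length (hitBy x bs) < b ^ r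
  firstColour {r} F₀ bs F₀≤K bs≤K |bs|< = x , x∉F₀ , ≤-<-trans (m≤n+m _ _) wx<t
    where
    t = b ^ r
    weight : Fin C → ℕ
    weight x = t * 𝟙[ x ∈ F₀ ] + length (hitBy x bs)
    ∑weight< : sum weight < C * t
    ∑weight< = begin-strict
      sum weight
        ≡⟨ ∑-distrib-+ (λ x → t * 𝟙[ x ∈ F₀ ]) (λ x → length (hitBy x bs)) ⟩
      ∑[ x < C ] (t * 𝟙[ x ∈ F₀ ]) + ∑[ x < C ] length (hitBy x bs)
        ≡⟨ cong (_+ _) (*-distribˡ-sum t (λ x → 𝟙[ x ∈ F₀ ])) ⟨
      t * ∑[ x < C ] 𝟙[ x ∈ F₀ ] + ∑[ x < C ] length (hitBy x bs)
        ≤⟨ +-mono-≤ (*-monoʳ-≤ t (≤-trans (∑𝟙∈≤length F₀) F₀≤K)) (∑-length-hitBy≤ bs bs≤K) ⟩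
      t * K + K * length bs
        <⟨ +-monoʳ-< (t * K) (*-monoʳ-< K |bs|<) ⟩
      t * K + K * (b * t)
        ≡⟨ lemma t K b ⟩
      (K + b * K) * t
        ≤⟨ *-monoˡ-≤ t K+bK≤C ⟩
      C * t
        ∎
      where
      open ≤-Reasoning
      lemma : ∀ t K b → t * K + K * (b * t) ≡ (K + b * K) * t
      lemma = solve-∀
    x = proj₁ (sum<⇒∃< t weight ∑weight<)
    wx<t = proj₂ (sum<⇒∃< t weight ∑weight<)
    x∉F₀ : x ∉ F₀
    x∉F₀ x∈F₀ = <⇒≱ wx<t (begin
      t                  ≡⟨ *-identityʳ t ⟨
      t * 1              ≡⟨ cong (t *_) (∈⇒𝟙≡1 x∈F₀) ⟨
      t * 𝟙[ x ∈ F₀ ]    ≤⟨ m≤m+n _ _ ⟩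
      weight x           ∎)
      where open ≤-Reasoning

  escapingVector : ∀ r (F : ColourSets r C) (bs : List (ColourSets r C)) →
           BoundedBy K F → All (BoundedBy K) bs → length bs < b ^ r →
           ∃ λ c → Avoids c F × All (Escapes c) bs
  escapingVector zero    F []      _   _    _          = (λ ()) , (λ ()) , []
  escapingVector zero    F (_ ∷ _) _   _    (s≤s ())
  escapingVector (suc r) F bs      F≤K bs≤K |bs|<
    with x , x∉F₀ , |hits|< ← firstColour (head F) bs (F≤K zero) bs≤K |bs|<
    with c , avoids , escapes ← escapingVector r (tail F) (hitBy x bs) (F≤K ∘ suc) (hitBy-bounded x bs bs≤K) |hits|<
    = x ∷ᵛ c , avoids-∷ x∉F₀ avoids , escapes-hitBy x c bs escapes

laterNbrs : Graph n → Fin n → Fin n → List (Fin n)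
laterNbrs H s p = filter (λ t → (s Fin.<? t) ×-dec adj? H p t) (allFin _)

module _ (H : Graph n) where

  ∈-laterNbrs : ∀ {s p t} → s <ᶠ t → Adj H p t → t ∈ laterNbrs H s p
  ∈-laterNbrs {t = t} s<t adj = ∈-filter⁺ _ (∈-allFin t) (s<t , adj)

  length-laterNbrs-antimono : ∀ {s s′} p → s ≤ᶠ s′ → length (laterNbrs H s′ p) ≤ length (laterNbrs H s p)
  length-laterNbrs-antimono {s} {s′} p s≤s′ = length-mono-≤
    (⊆-filter⁺ (λ t → (s′ Fin.<? t) ×-dec adj? H p t) (λ t → (s Fin.<? t) ×-dec adj? H p t)
               (λ { refl (s′<t , adj) → ≤-<-trans s≤s′ s′<t , adj }) (⊆-refl {x = allFin _}))

  SeparatedBy : ∀ {C} → (Fin n → Fin C) → Fin n → Fin n → Set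
  SeparatedBy g i j = ∀ t → j <ᶠ t → Adj H i t → g j ≢ g t

∉-map⇒≢ : ∀ {A B : Set} {f : A → B} {y xs x} → y ∉ map f xs → x ∈ xs → y ≢ f x
∉-map⇒≢ {f = f} y∉ x∈ refl = y∉ (∈-map⁺ f x∈)

module Construction {n r C} (H : Graph n) (b K : ℕ) .{{_ : NonZero K}} (K+bK≤C : K + b * K ≤ C)
                    (n≤b^r : n ≤ b ^ r) (degenerate : ∀ p → length (laterNbrs H p p) ≤ K) where

  open Choice b K K+bK≤C

  -- Positions below s are not coloured yet: their colours are placeholders.
  record Stage (s : ℕ) : Set where
    field
      colour    : Fin r → Fin n → Fin C
      proper    : ∀ ℓ p q → s ≤ toℕ p → s ≤ toℕ q → Adj H p q → colour ℓ p ≢ colour ℓ q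
      separates : ∀ i j → i <ᶠ j → s ≤ toℕ j → ∃ λ ℓ → SeparatedBy H (colour ℓ) i j

  someColour : Fin C
  someColour = fromℕ< (<-≤-trans (>-nonZero⁻¹ K) (≤-trans (m≤m+n K (b * K)) K+bK≤C))

  initial : ∀ {s} → n ≤ s → Stage s
  initial {s} n≤s = record
    { colour    = λ _ _ → someColour
    ; proper    = λ _ p _ s≤p → contradiction (≤-trans n≤s s≤p) (<⇒≱ (Fin.toℕ<n p))
    ; separates = λ _ j _ s≤j → contradiction (≤-trans n≤s s≤j) (<⇒≱ (Fin.toℕ<n j))
    }

  module Extend (P : Fin n) (st : Stage (suc (toℕ P))) where
    open Stage st

    laterColours : Fin n → ColourSets r C
    laterColours i ℓ = map (colour ℓ) (laterNbrs H P i)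

    earlier : List (Fin n)
    earlier = filter (Fin._<? P) (allFin n)

    laterColours-bounded : ∀ {i} → i ≤ᶠ P → BoundedBy K (laterColours i)
    laterColours-bounded {i} i≤P ℓ = begin
      length (laterColours i ℓ)   ≡⟨ length-map (colour ℓ) (laterNbrs H P i) ⟩
      length (laterNbrs H P i)    ≤⟨ length-laterNbrs-antimono H i i≤P ⟩
      length (laterNbrs H i i)    ≤⟨ degenerate i ⟩
      K                           ∎
      where open ≤-Reasoning

    few-earlier : length (map laterColours earlier) < b ^ r
    few-earlier = begin-strict
      length (map laterColours earlier)  ≡⟨ length-map laterColours earlier ⟩
      length earlier                     <⟨ filter-notAll (Fin._<? P) (allFin n)
                                              (Any.map (λ { refl → Fin.<-irrefl refl }) (∈-allFin P)) ⟩
      length (allFin n)                  ≡⟨ length-tabulate _ ⟩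
      n                                  ≤⟨ n≤b^r ⟩
      b ^ r                              ∎
      where open ≤-Reasoning

    choice : ∃ λ c → Avoids c (laterColours P) × All (Escapes c) (map laterColours earlier)
    choice = escapingVector r (laterColours P) (map laterColours earlier) (laterColours-bounded Fin.≤-refl)
               (map⁺ (All.map (laterColours-bounded ∘ <⇒≤) (all-filter (Fin._<? P) (allFin n)))) few-earlier

    c : Fin r → Fin C
    c = proj₁ choice

    c-avoids : Avoids c (laterColours P)
    c-avoids = proj₁ (proj₂ choice)

    c-escapes : ∀ i → i <ᶠ P → Escapes c (laterColours i)
    c-escapes i i<P = All.lookup (map⁻ (proj₂ (proj₂ choice))) (∈-filter⁺ (Fin._<? P) (∈-allFin i) i<P)

    colour′ : Fin r → Fin n → Fin C
    colour′ ℓ = updateAt (colour ℓ) P (const (c ℓ))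

    colour′-P : ∀ ℓ → colour′ ℓ P ≡ c ℓ
    colour′-P ℓ = updateAt-updates P (colour ℓ)

    colour′-later : ∀ ℓ {p} → P <ᶠ p → colour′ ℓ p ≡ colour ℓ p
    colour′-later ℓ {p} P<p = updateAt-minimal p P (colour ℓ) (≢-sym (Fin.<⇒≢ P<p))

    P≤∧≢P⇒P< : ∀ {p} → toℕ P ≤ toℕ p → p ≢ P → P <ᶠ p
    P≤∧≢P⇒P< P≤p p≢P = Fin.≤∧≢⇒< P≤p (≢-sym p≢P)

    colour′-P-fresh : ∀ ℓ q → P <ᶠ q → Adj H P q → colour′ ℓ P ≢ colour′ ℓ q
    colour′-P-fresh ℓ q P<q adj rewrite colour′-P ℓ | colour′-later ℓ P<q =
      ∉-map⇒≢ (c-avoids ℓ) (∈-laterNbrs H P<q adj)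

    proper′ : ∀ ℓ p q → toℕ P ≤ toℕ p → toℕ P ≤ toℕ q → Adj H p q → colour′ ℓ p ≢ colour′ ℓ q
    proper′ ℓ p q P≤p P≤q adj with p Fin.≟ P | q Fin.≟ P
    ... | yes refl | yes refl = contradiction adj (Graph.irrefl H)
    ... | yes refl | no  q≢P  = colour′-P-fresh ℓ q (P≤∧≢P⇒P< P≤q q≢P) adj
    ... | no  p≢P  | yes refl = ≢-sym (colour′-P-fresh ℓ p (P≤∧≢P⇒P< P≤p p≢P) (Graph.sym H adj))
    ... | no  p≢P  | no  q≢P
      rewrite colour′-later ℓ (P≤∧≢P⇒P< P≤p p≢P) | colour′-later ℓ (P≤∧≢P⇒P< P≤q q≢P) =
      proper ℓ p q (P≤∧≢P⇒P< P≤p p≢P) (P≤∧≢P⇒P< P≤q q≢P) adj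

    separates′ : ∀ i j → i <ᶠ j → toℕ P ≤ toℕ j → ∃ λ ℓ → SeparatedBy H (colour′ ℓ) i j
    separates′ i j i<j P≤j with j Fin.≟ P
    ... | yes refl = let ℓ , cℓ∉laterColours = c-escapes i i<j in
      ℓ , λ t P<t adj → subst₂ _≢_ (sym (colour′-P ℓ)) (sym (colour′-later ℓ P<t))
                          (∉-map⇒≢ cℓ∉laterColours (∈-laterNbrs H P<t adj))
    ... | no  j≢P  = let ℓ , separated = separates i j i<j (P≤∧≢P⇒P< P≤j j≢P) in
      ℓ , λ t j<t adj → subst₂ _≢_ (sym (colour′-later ℓ P<j)) (sym (colour′-later ℓ (Fin.<-trans P<j j<t)))
                          (separated t j<t adj)
      where P<j = P≤∧≢P⇒P< P≤j j≢P

    stage : Stage (toℕ P)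
    stage = record { colour = colour′ ; proper = proper′ ; separates = separates′ }

  stageAt : ∀ (s : Fin (suc n)) → Stage (toℕ s)
  stageAt = >-weakInduction (Stage ∘ toℕ) (initial (≤-reflexive (sym (Fin.toℕ-fromℕ n))))
                            (λ P st → subst Stage (sym (Fin.toℕ-inject₁ P)) (Extend.stage P st))

  colouring : Fin r → Fin n → Fin C
  colouring = Stage.colour (stageAt zero)

  colouring-proper : ∀ ℓ p q → Adj H p q → colouring ℓ p ≢ colouring ℓ q
  colouring-proper ℓ p q = Stage.proper (stageAt zero) ℓ p q z≤n z≤n

  colouring-separates : ∀ i j → i <ᶠ j → ∃ λ ℓ → SeparatedBy H (colouring ℓ) i j
  colouring-separates i j i<j = Stage.separates (stageAt zero) i j i<j z≤n

-- Adjacency of positions p, q is adjacency of v_p, v_q, so laterDeg G σ is literally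
-- the later-degree of the pulled-back graph in the identity ordering.
pullback : Graph n → Ordering n → Graph n
pullback G σ = record
  { Adj    = λ p q → Adj G (vtx σ p) (vtx σ q)
  ; sym    = Graph.sym G
  ; irrefl = Graph.irrefl G
  ; adj?   = λ p q → adj? G (vtx σ p) (vtx σ q)
  }

module _ (G : Graph n) (σ : Ordering n) {C} {g : Fin n → Fin C} where
  open Inverse (⤖⇒↔ σ) using (from; strictlyInverseˡ; strictlyInverseʳ)

  proper-∘from : (∀ p q → Adj (pullback G σ) p q → g p ≢ g q) → Proper G (g ∘ from)
  proper-∘from proper u w adj = proper (from u) (from w)
    (subst₂ (Adj G) (sym (strictlyInverseˡ u)) (sym (strictlyInverseˡ w)) adj)

  separated⇒desirable : ∀ {i j} → Proper G (g ∘ from) → SeparatedBy (pullback G σ) g i j →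
                        Desirable G σ (g ∘ from) i j
  separated⇒desirable proper separated = proper , λ t j<t adj →
    subst₂ _≢_ (sym (cong g (strictlyInverseʳ _))) (sym (cong g (strictlyInverseʳ t))) (separated t j<t adj)

lemma10 : (k : ℕ) → 1 ≤ k → (n : ℕ) → (G : Graph n) → (σ : Ordering n) →
          IsDegenerateOrdering k G σ → (r : ℕ) → IsCeilLn n r →
          Σ (Fin r → Fin n → Fin (10 * k)) λ f →
            (∀ ℓ → Proper G (f ℓ)) ×
            (∀ i j → i <ᶠ j → ¬ Adj G (vtx σ i) (vtx σ j) →
              ∃ λ ℓ → Desirable G σ (f ℓ) i j)
lemma10 k 1≤k n G σ degenerate r (n≤e^r , _) = (λ ℓ → colouring ℓ ∘ from) , proper , desirable
  where
  instance
    k≢0 : NonZero k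
    k≢0 = >-nonZero 1≤k
  tenfold : ∀ k → k + 9 * k ≡ 10 * k
  tenfold = solve-∀
  open Inverse (⤖⇒↔ σ) using (from)
  open Construction {r = r} (pullback G σ) 9 k (≤-reflexive (tenfold k)) (LeExp⇒≤9^ n≤e^r) degenerate

  proper : ∀ ℓ → Proper G (colouring ℓ ∘ from)
  proper ℓ = proper-∘from G σ (colouring-proper ℓ)

  desirable : ∀ i j → i <ᶠ j → ¬ Adj G (vtx σ i) (vtx σ j) → ∃ λ ℓ → Desirable G σ (colouring ℓ ∘ from) i j
  desirable i j i<j _ = let ℓ , separated = colouring-separates i j i<j in
    ℓ , separated⇒desirable G σ (proper ℓ) separated
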